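{- Let $0<\epsilon<1/3$, let $k\geq 2$, and let $G=(V,E)$ be a $k$-partite $k$-uniform hypergraph with vertex partition $V=V_1\cup V_2\cup\dots\cup V_k$. Suppose that for all sets $U_1,\dots,U_k$ with $U_i\subseteq V_i$ and $|U_i|\geq \epsilon|V_i|$ for all $i\in[k]$, there exists an edge $\{u_1,\dots,u_k\}$ of $G$ with $u_i\in U_i$ for all $i\in[k]$. Then $G$ contains a connected component $H$ such that $|V(H)\cap V_i|\geq (1-\epsilon)|V_i|$ for all $i\in[k]$.
   Context: A $k$-partite $k$-uniform hypergraph with parts $V_1,\dots,V_k$ is one in which every edge contains exactly one vertex from each $V_i$. A hypergraph is connected if its shadow graph (two vertices adjacent iff they lie in a common edge) is connected; a component is a maximal connected subhypergraph.
   Formalization: The parameter ε ranges over the rationals satisfying $0<\epsilon<1/3$. -}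

module Defs where

open import Data.Nat using (ℕ)
open import Data.Fin using (Fin)
open import Data.Fin.Subset using (Subset; _∈_; ∣_∣)
open import Data.List using (List)
import Data.List.Membership.Propositional as LM
open import Data.Product using (Σ; _×_; ∃)
open import Data.Integer using (+_)
open import Data.Rational using (ℚ; _/_; _*_; _-_; _≤_)
open import Relation.Binary.PropositionalEquality using (_≡_)
open import Relation.Binary.Construct.Closure.ReflexiveTransitive using (Star)

⟦_⟧ : ℕ → ℚ
⟦ n ⟧ = (+ n) / 1

-- A finite k-partite k-uniform hypergraph: part i is V_i = Fin (sizes i);
-- an edge {u_1,…,u_k} with u_i ∈ V_i is a choice function.
record KPartite (k : ℕ) : Set where
  field
    sizes : Fin k → ℕ
    edges : List ((i : Fin k) → Fin (sizes i))

module _ {k : ℕ} (G : KPartite k) where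
  open KPartite G

  Edge : Set
  Edge = (i : Fin k) → Fin (sizes i)

  Vertex : Set
  Vertex = Σ (Fin k) (λ i → Fin (sizes i))

  _∈ₑ_ : Vertex → Edge → Set
  (i Data.Product., x) ∈ₑ e = e i ≡ x

  Adjacent : Vertex → Vertex → Set
  Adjacent v w = ∃ λ e → (e LM.∈ edges) × (v ∈ₑ e) × (w ∈ₑ e)

  Connected : Vertex → Vertex → Set
  Connected = Star Adjacent

-- Call a vertex set closed if every edge meeting it lies inside it. If a closed set A is
-- ε-large in part i, its complement cannot be ε-large in another part j, since the hypothesis
-- would give an edge from A ∩ V_i to V_j ∖ A; so a closed set that is ε-large in every part
-- misses fewer than ε|V_j| vertices of each V_j. Keep a closed set A, ε-large in every part,
-- starting from V. It contains an edge; let C be the component of that edge. Either C is ε-large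
-- everywhere, and is the required component, or C is small in some part, hence its complement is
-- large there (2ε ≤ 1), hence C is small in every part. Then A ∖ C is again closed, and ε-large
-- in every part because 3ε ≤ 1, and it is strictly smaller than A.

module Submission where

open import Defs
open import Data.Nat using (ℕ; _≥_)
open import Data.Fin using (Fin)
open import Data.Fin.Subset using (Subset; _∈_; ∣_∣)
open import Data.List.Membership.Propositional using () renaming (_∈_ to _∈ₗ_)
open import Data.Product using (Σ; _×_; ∃; _,_)
open import Data.Integer using (+_)
open import Data.Rational using (ℚ; _/_; _*_; _-_; _<_; _≤_)

import Algebra.Properties.Monoid.Sum
open import Data.Empty using (⊥-elim)
open import Data.Fin using (zero; suc)
open import Data.Fin.Properties using (_≟_; any?; all?; ¬∀⟶∃¬)
open import Data.Fin.Subset using (inside; outside; _∉_; _⊆_; _⊂_; ⁅_⁆; ∁; ⊤; ⋃; _∪_; _─_)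
open import Data.Fin.Subset.Properties
open import Data.Integer as ℤ using ()
import Data.Integer.Properties as ℤₚ
open import Data.List using (List; []; _∷_; map; filter)
open import Data.List.Membership.Propositional.Properties using (∈-map⁺; ∈-map⁻; ∈-filter⁺; ∈-filter⁻)
open import Data.List.Relation.Unary.Any using (here; there)
open import Data.Nat as ℕ using (zero; suc; z≤n; s≤s)
open import Data.Nat.Coprimality using (1-coprimeTo) renaming (sym to coprime-sym)
open import Data.Nat.Induction using (<-wellFounded)
import Data.Nat.Properties as ℕₚ
open import Data.Product using (proj₁; proj₂)
import Data.Product as Product
open import Data.Rational using (mkℚ; 0ℚ; 1ℚ; _+_; -_; NonNegative)
open import Data.Rational.Properties
  using (normalize-coprime; normalize-nonNeg; nonNegative⁻¹; ≤-trans; ≤-<-trans; <⇒≤; ≰⇒>; <-irrefl; _≤?_;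
         module ≤-Reasoning;
         +-mono-≤; +-mono-<; +-monoʳ-≤; +-monoˡ-<; +-monoʳ-<; +-identityʳ;
         *-monoʳ-≤-nonNeg; *-zeroˡ; *-identityˡ)
open import Data.Rational.Solver using (module +-*-Solver)
open import Data.Sum using (_⊎_; inj₁; inj₂; [_,_]′)
import Data.Sum as Sum
open import Data.Vec.Base using (_∷_; []) renaming (here to hereᵥ; there to thereᵥ)
open import Function using (_∘_; id)
open import Induction.WellFounded using (Acc; acc)
open import Relation.Binary.Construct.Closure.ReflexiveTransitive as Star using (_◅_; _◅◅_)
open import Relation.Binary.PropositionalEquality
  using (_≡_; _≢_; refl; sym; trans; cong; cong₂; subst; module ≡-Reasoning)
open import Relation.Nullary using (Dec; yes; no; ¬_; contradiction)

∣p∣+∣∁p∣≡n : ∀ {n} (p : Subset n) → ∣ p ∣ ℕ.+ ∣ ∁ p ∣ ≡ n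
∣p∣+∣∁p∣≡n p = trans (cong (∣ p ∣ ℕ.+_) (∣∁p∣≡n∸∣p∣ p)) (ℕₚ.m+[n∸m]≡n (∣p∣≤n p))

∣p─q∣+∣q∣≡∣p∣ : ∀ {n} {p q : Subset n} → q ⊆ p → ∣ p ─ q ∣ ℕ.+ ∣ q ∣ ≡ ∣ p ∣
∣p─q∣+∣q∣≡∣p∣ {p = []}          {[]}          _   = refl
∣p─q∣+∣q∣≡∣p∣ {p = inside  ∷ p} {inside  ∷ q} q⊆p =
  trans (ℕₚ.+-suc _ _) (cong suc (∣p─q∣+∣q∣≡∣p∣ (drop-∷-⊆ q⊆p)))
∣p─q∣+∣q∣≡∣p∣ {p = inside  ∷ p} {outside ∷ q} q⊆p = cong suc (∣p─q∣+∣q∣≡∣p∣ (drop-∷-⊆ q⊆p))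
∣p─q∣+∣q∣≡∣p∣ {p = outside ∷ p} {outside ∷ q} q⊆p = ∣p─q∣+∣q∣≡∣p∣ (drop-∷-⊆ q⊆p)
∣p─q∣+∣q∣≡∣p∣ {p = outside ∷ p} {inside  ∷ q} q⊆p = contradiction (q⊆p hereᵥ) λ ()

x∈p─q⇒x∉q : ∀ {n} {p q : Subset n} {x} → x ∈ p ─ q → x ∉ q
x∈p─q⇒x∉q {p = _ ∷ p} {outside ∷ q} (thereᵥ x∈p─q) (thereᵥ x∈q) = x∈p─q⇒x∉q {p = p} x∈p─q x∈q
x∈p─q⇒x∉q {p = _ ∷ p} {inside  ∷ q} (thereᵥ x∈p─q) (thereᵥ x∈q) = x∈p─q⇒x∉q {p = p} x∈p─q x∈q

x∈⋃⁺ : ∀ {n} {ps : List (Subset n)} {p x} → p ∈ₗ ps → x ∈ p → x ∈ ⋃ ps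
x∈⋃⁺ (here refl)  x∈p = x∈p∪q⁺ (inj₁ x∈p)
x∈⋃⁺ (there p∈ps) x∈p = x∈p∪q⁺ (inj₂ (x∈⋃⁺ p∈ps x∈p))

x∈⋃⁻ : ∀ {n} (ps : List (Subset n)) {x} → x ∈ ⋃ ps → ∃ λ p → p ∈ₗ ps × x ∈ p
x∈⋃⁻ []       x∈⊥ = contradiction x∈⊥ ∉⊥
x∈⋃⁻ (p ∷ ps) x∈⋃ with x∈p∪q⁻ p (⋃ ps) x∈⋃
... | inj₁ x∈p   = p , here refl , x∈p
... | inj₂ x∈⋃ps = Product.map₂ (Product.map₁ there) (x∈⋃⁻ ps x∈⋃ps)

open Algebra.Properties.Monoid.Sum ℕₚ.+-0-monoid using (sum)

sum-mono-≤ : ∀ {m} {f g : Fin m → ℕ} → (∀ i → f i ℕ.≤ g i) → sum f ℕ.≤ sum g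
sum-mono-≤ {zero}  f≤g = z≤n
sum-mono-≤ {suc m} f≤g = ℕₚ.+-mono-≤ (f≤g zero) (sum-mono-≤ (f≤g ∘ suc))

sum-mono-< : ∀ {m} {f g : Fin m → ℕ} → (∀ i → f i ℕ.≤ g i) → ∀ j → f j ℕ.< g j → sum f ℕ.< sum g
sum-mono-< f≤g zero    fj<gj = ℕₚ.+-mono-<-≤ fj<gj (sum-mono-≤ (f≤g ∘ suc))
sum-mono-< f≤g (suc j) fj<gj = ℕₚ.+-mono-≤-< (f≤g zero) (sum-mono-< (f≤g ∘ suc) j fj<gj)

-- ⟦ m ⟧ normalises to mkℚ (+ m) 0, on which ℚ addition computes.
⟦⟧-homo-+ : ∀ m n → ⟦ m ℕ.+ n ⟧ ≡ ⟦ m ⟧ + ⟦ n ⟧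
⟦⟧-homo-+ m n = begin
  ⟦ m ℕ.+ n ⟧
    ≡⟨ cong (_/ 1) (cong₂ ℤ._+_ (ℤₚ.*-identityʳ (+ m)) (ℤₚ.*-identityʳ (+ n))) ⟨
  (+ m ℤ.* + 1 ℤ.+ + n ℤ.* + 1) / 1    ≡⟨⟩
  mkℚ (+ m) 0 c + mkℚ (+ n) 0 d        ≡⟨ cong₂ _+_ (normalize-coprime c) (normalize-coprime d) ⟨
  ⟦ m ⟧ + ⟦ n ⟧                        ∎
  where
  open ≡-Reasoning
  c = coprime-sym (1-coprimeTo m)
  d = coprime-sym (1-coprimeTo n)

⟦⟧-nonNeg : ∀ n → NonNegative ⟦ n ⟧
⟦⟧-nonNeg n = normalize-nonNeg n 1

co-small⇒[1-ε]-large : ∀ ε {a b n} → a ℕ.+ b ≡ n →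
  ⟦ b ⟧ < ε * ⟦ n ⟧ → ((+ 1) / 1 - ε) * ⟦ n ⟧ ≤ ⟦ a ⟧
co-small⇒[1-ε]-large ε {a} {b} {n} refl b<εn = <⇒≤ (begin-strict
  ((+ 1) / 1 - ε) * ⟦ a ℕ.+ b ⟧        ≡⟨ solve 2 (λ x y → (con 1ℚ :- x) :* y := y :- x :* y) refl ε ⟦ a ℕ.+ b ⟧ ⟩
  ⟦ a ℕ.+ b ⟧ - ε * ⟦ n ⟧              ≡⟨ cong (_- ε * ⟦ n ⟧) (⟦⟧-homo-+ a b) ⟩
  ⟦ a ⟧ + ⟦ b ⟧ - ε * ⟦ n ⟧            <⟨ +-monoˡ-< (- (ε * ⟦ n ⟧)) (+-monoʳ-< ⟦ a ⟧ b<εn) ⟩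
  ⟦ a ⟧ + ε * ⟦ n ⟧ - ε * ⟦ n ⟧        ≡⟨ solve 2 (λ x y → x :+ y :- y := x) refl ⟦ a ⟧ (ε * ⟦ n ⟧) ⟩
  ⟦ a ⟧                                ∎)
  where
  open ≤-Reasoning
  open +-*-Solver using (solve; _:+_; _:*_; _:-_; _:=_; con)

module Threshold (ε : ℚ) (0≤ε : 0ℚ ≤ ε) (ε≤⅓ : ε ≤ (+ 1) / 3) where

  0≤ε*n : ∀ n → 0ℚ ≤ ε * ⟦ n ⟧
  0≤ε*n n = subst (_≤ ε * ⟦ n ⟧) (*-zeroˡ ⟦ n ⟧) (*-monoʳ-≤-nonNeg ⟦ n ⟧ {{⟦⟧-nonNeg n}} 0≤ε)

  x≤x+ε*n : ∀ x n → x ≤ x + ε * ⟦ n ⟧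
  x≤x+ε*n x n = subst (_≤ x + ε * ⟦ n ⟧) (+-identityʳ x) (+-monoʳ-≤ x (0≤ε*n n))

  3ε*n≤n : ∀ n → ε * ⟦ n ⟧ + ε * ⟦ n ⟧ + ε * ⟦ n ⟧ ≤ ⟦ n ⟧
  3ε*n≤n n = begin
    ε * ⟦ n ⟧ + ε * ⟦ n ⟧ + ε * ⟦ n ⟧
      ≡⟨ solve 2 (λ x y → x :* y :+ x :* y :+ x :* y := (x :+ x :+ x) :* y) refl ε ⟦ n ⟧ ⟩
    (ε + ε + ε) * ⟦ n ⟧
      ≤⟨ *-monoʳ-≤-nonNeg ⟦ n ⟧ {{⟦⟧-nonNeg n}} (+-mono-≤ (+-mono-≤ ε≤⅓ ε≤⅓) ε≤⅓) ⟩
    ((+ 1) / 3 + (+ 1) / 3 + (+ 1) / 3) * ⟦ n ⟧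
      ≡⟨ *-identityˡ ⟦ n ⟧ ⟩
    ⟦ n ⟧ ∎
    where
    open ≤-Reasoning
    open +-*-Solver using (solve; _:+_; _:*_; _:=_)

  ε*n≤n : ∀ n → ε * ⟦ n ⟧ ≤ ⟦ n ⟧
  ε*n≤n n = ≤-trans (x≤x+ε*n _ n) (≤-trans (x≤x+ε*n _ n) (3ε*n≤n n))

  two-small⇒ε-large : ∀ {a b c n} → a ℕ.+ b ℕ.+ c ≡ n →
    ⟦ b ⟧ < ε * ⟦ n ⟧ → ⟦ c ⟧ < ε * ⟦ n ⟧ → ε * ⟦ n ⟧ ≤ ⟦ a ⟧
  two-small⇒ε-large {a} {b} {c} {n} refl b<εn c<εn with ε * ⟦ n ⟧ ≤? ⟦ a ⟧
  ... | yes εn≤a = εn≤a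
  ... | no  εn≰a = contradiction n<n (<-irrefl refl)
    where
    open ≤-Reasoning
    n<n : ⟦ n ⟧ < ⟦ n ⟧
    n<n = begin-strict
      ⟦ a ℕ.+ b ℕ.+ c ⟧                 ≡⟨ ⟦⟧-homo-+ (a ℕ.+ b) c ⟩
      ⟦ a ℕ.+ b ⟧ + ⟦ c ⟧               ≡⟨ cong (_+ ⟦ c ⟧) (⟦⟧-homo-+ a b) ⟩
      ⟦ a ⟧ + ⟦ b ⟧ + ⟦ c ⟧             <⟨ +-mono-< (+-mono-< (≰⇒> εn≰a) b<εn) c<εn ⟩
      ε * ⟦ n ⟧ + ε * ⟦ n ⟧ + ε * ⟦ n ⟧ ≤⟨ 3ε*n≤n n ⟩
      ⟦ n ⟧                             ∎

  ¬ε-large⇒co-ε-large : ∀ {a b n} → a ℕ.+ b ≡ n → ¬ ε * ⟦ n ⟧ ≤ ⟦ a ⟧ → ε * ⟦ n ⟧ ≤ ⟦ b ⟧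
  ¬ε-large⇒co-ε-large {a} {b} {n} a+b≡n εn≰a = two-small⇒ε-large {b} {a} {0} b+a+0≡n a<εn 0<εn
    where
    b+a+0≡n : b ℕ.+ a ℕ.+ 0 ≡ n
    b+a+0≡n = trans (ℕₚ.+-identityʳ _) (trans (ℕₚ.+-comm b a) a+b≡n)
    a<εn : ⟦ a ⟧ < ε * ⟦ n ⟧
    a<εn = ≰⇒> εn≰a
    0<εn : ⟦ 0 ⟧ < ε * ⟦ n ⟧
    0<εn = ≤-<-trans (nonNegative⁻¹ ⟦ a ⟧ {{⟦⟧-nonNeg a}}) a<εn

module Components {k : ℕ} (G : KPartite k) where
  open KPartite G

  VertexSet : Set
  VertexSet = (i : Fin k) → Subset (sizes i)

  _∈ᵛ_ : Vertex G → VertexSet → Set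
  (i , x) ∈ᵛ A = x ∈ A i

  _⊆ᵛ_ : VertexSet → VertexSet → Set
  A ⊆ᵛ B = ∀ i → A i ⊆ B i

  _─ᵛ_ : VertexSet → VertexSet → VertexSet
  (A ─ᵛ B) i = A i ─ B i

  Meets : Edge G → VertexSet → Set
  Meets e A = ∃ λ i → e i ∈ A i

  meets? : ∀ e A → Dec (Meets e A)
  meets? e A = any? (λ i → e i ∈? A i)

  Closed : VertexSet → Set
  Closed A = ∀ {e} → e ∈ₗ edges → Meets e A → ∀ j → e j ∈ A j

  Reached : Vertex G → VertexSet → Set
  Reached v A = ∀ {w} → w ∈ᵛ A → Connected G v w

  closed-reach : ∀ {A v w} → Closed A → v ∈ᵛ A → Connected G v w → w ∈ᵛ A
  closed-reach closed v∈A Star.ε = v∈A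
  closed-reach closed v∈A ((e , e∈E , refl , refl) ◅ path) = closed-reach closed (closed e∈E (_ , v∈A) _) path

  reached⊆closed : ∀ {A C v} → Closed A → v ∈ᵛ A → Reached v C → C ⊆ᵛ A
  reached⊆closed closed v∈A reached i x∈C = closed-reach closed v∈A (reached x∈C)

  ─ᵛ-closed : ∀ {A B} → Closed A → Closed B → Closed (A ─ᵛ B)
  ─ᵛ-closed {A} {B} A-closed B-closed e∈E (i , ei∈A─B) j =
    x∈p∧x∉q⇒x∈p─q (A-closed e∈E (i , p─q⊆p (A i) (B i) ei∈A─B) j)
                  (λ ej∈B → x∈p─q⇒x∉q {p = A i} ei∈A─B (B-closed e∈E (j , ej∈B) i))

  expand : VertexSet → VertexSet
  expand S j = S j ∪ ⋃ (map (λ e → ⁅ e j ⁆) (filter (λ e → meets? e S) edges))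

  ⊆-expand : ∀ S → S ⊆ᵛ expand S
  ⊆-expand S j x∈S = x∈p∪q⁺ (inj₁ x∈S)

  meets⇒⊆-expand : ∀ {S e} → e ∈ₗ edges → Meets e S → ∀ j → e j ∈ expand S j
  meets⇒⊆-expand {S} e∈E meets j =
    x∈p∪q⁺ (inj₂ (x∈⋃⁺ (∈-map⁺ _ (∈-filter⁺ (λ e → meets? e S) e∈E meets)) (x∈⁅x⁆ _)))

  ∈-expand⁻ : ∀ {S j x} → x ∈ expand S j → x ∈ S j ⊎ ∃ λ e → e ∈ₗ edges × Meets e S × e j ≡ x
  ∈-expand⁻ {S} {j} x∈ with x∈p∪q⁻ (S j) _ x∈
  ... | inj₁ x∈S = inj₁ x∈S
  ... | inj₂ x∈⋃ with x∈⋃⁻ _ x∈⋃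
  ...   | _ , p∈ , x∈p with ∈-map⁻ (λ (e : Edge G) → ⁅ e j ⁆) p∈
  ...     | e , e∈ , refl with ∈-filter⁻ (λ e → meets? e S) e∈
  ...       | e∈E , meets = inj₂ (e , e∈E , meets , sym (x∈⁅y⁆⇒x≡y _ x∈p))

  size : VertexSet → ℕ
  size S = sum (λ i → ∣ S i ∣)

  size≤total : ∀ S → size S ℕ.≤ sum sizes
  size≤total S = sum-mono-≤ (λ i → ∣p∣≤n (S i))

  stable⇒closed : ∀ {S} → (∀ j → ¬ S j ⊂ expand S j) → Closed S
  stable⇒closed {S} stable {e} e∈E meets j with e j ∈? S j
  ... | yes ej∈S = ej∈S
  ... | no  ej∉S = ⊥-elim (stable j (⊆-expand S j , e j , meets⇒⊆-expand e∈E meets j , ej∉S))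

  -- Each round that is not stable adds a vertex, so sum sizes rounds suffice.
  saturate : (P : VertexSet → Set) → (∀ {S} → P S → P (expand S)) →
             ∀ fuel S → sum sizes ℕ.≤ size S ℕ.+ fuel → P S → ∃ λ C → Closed C × P C
  saturate P P-expand fuel S bound PS with any? (λ j → S j ⊂? expand S j)
  ... | no stable = S , stable⇒closed (λ j → stable ∘ (j ,_)) , PS
  ... | yes (j , S⊂) = continue fuel bound
    where
    grows : size S ℕ.< size (expand S)
    grows = sum-mono-< (λ i → p⊆q⇒∣p∣≤∣q∣ (⊆-expand S i)) j (p⊂q⇒∣p∣<∣q∣ S⊂)

    continue : ∀ fuel → sum sizes ℕ.≤ size S ℕ.+ fuel → ∃ λ C → Closed C × P C
    continue zero bound = contradiction
      (ℕₚ.≤-trans (size≤total (expand S)) (ℕₚ.≤-trans bound (ℕₚ.≤-reflexive (ℕₚ.+-identityʳ _))))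
      (ℕₚ.<⇒≱ grows)
    continue (suc fuel) bound = saturate P P-expand fuel (expand S)
      (ℕₚ.≤-trans bound (ℕₚ.≤-trans (ℕₚ.≤-reflexive (ℕₚ.+-suc _ fuel)) (ℕₚ.+-monoˡ-≤ fuel grows)))
      (P-expand PS)

  edge-component : ∀ {e} → e ∈ₗ edges → (i : Fin k) →
                   ∃ λ C → Closed C × (∀ j → e j ∈ C j) × Reached (i , e i) C
  edge-component {e} e∈E i =
    saturate P P-expand (sum sizes) (λ j → ⁅ e j ⁆) (ℕₚ.m≤n+m _ _) ((λ j → x∈⁅x⁆ (e j)) , reached₀)
    where
    P : VertexSet → Set
    P C = (∀ j → e j ∈ C j) × Reached (i , e i) C

    reached₀ : Reached (i , e i) (λ j → ⁅ e j ⁆)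
    reached₀ {j , x} x∈e = (e , e∈E , refl , sym (x∈⁅y⁆⇒x≡y (e j) x∈e)) ◅ Star.ε

    P-expand : ∀ {S} → P S → P (expand S)
    P-expand {S} (e⊆S , reached) = (λ j → ⊆-expand S j (e⊆S j)) , reached′
      where
      reached′ : Reached (i , e i) (expand S)
      reached′ {j , x} x∈ with ∈-expand⁻ {S} x∈
      ... | inj₁ x∈S = reached x∈S
      ... | inj₂ (f , f∈E , (l , fl∈S) , fj≡x) = reached fl∈S ◅◅ ((f , f∈E , refl , fj≡x) ◅ Star.ε)

module GiantComponent (ε : ℚ) (0≤ε : 0ℚ ≤ ε) (ε≤⅓ : ε ≤ (+ 1) / 3)
                      {k : ℕ} (G : KPartite (suc (suc k))) where
  open KPartite G
  open Components G
  open Threshold ε 0≤ε ε≤⅓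

  LargeIn : (i : Fin (suc (suc k))) → Subset (sizes i) → Set
  LargeIn i s = ε * ⟦ sizes i ⟧ ≤ ⟦ ∣ s ∣ ⟧

  Large : VertexSet → Set
  Large A = ∀ i → LargeIn i (A i)

  largeIn? : ∀ i s → Dec (LargeIn i s)
  largeIn? i s = ε * ⟦ sizes i ⟧ ≤? ⟦ ∣ s ∣ ⟧

  Small : VertexSet → Set
  Small A = ∀ i → ⟦ ∣ A i ∣ ⟧ < ε * ⟦ sizes i ⟧

  Dense : Set
  Dense = (U : VertexSet) → Large U → ∃ λ e → (e ∈ₗ edges) × (∀ i → e i ∈ U i)

  ⊤-large : ∀ i → LargeIn i ⊤
  ⊤-large i = subst (λ m → ε * ⟦ sizes i ⟧ ≤ ⟦ m ⟧) (sym (∣⊤∣≡n (sizes i))) (ε*n≤n (sizes i))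

  ¬large⇒co-large : ∀ {i} {s : Subset (sizes i)} → ¬ LargeIn i s → LargeIn i (∁ s)
  ¬large⇒co-large {i} {s} = ¬ε-large⇒co-ε-large {∣ s ∣} {∣ ∁ s ∣} {sizes i} (∣p∣+∣∁p∣≡n s)

  another : (i : Fin (suc (suc k))) → ∃ λ j → j ≢ i
  another zero    = suc zero , λ ()
  another (suc i) = zero , λ ()

  probe : VertexSet → Fin (suc (suc k)) → Fin (suc (suc k)) → VertexSet
  probe A i j l with l ≟ j | l ≟ i
  ... | yes _ | _     = ∁ (A l)
  ... | no _  | yes _ = A l
  ... | no _  | no _  = ⊤

  probe-large : ∀ A {i j} → LargeIn i (A i) → LargeIn j (∁ (A j)) → Large (probe A i j)
  probe-large A {i} {j} Ai-large ∁Aj-large l with l ≟ j | l ≟ i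
  ... | yes refl | _        = ∁Aj-large
  ... | no _     | yes refl = Ai-large
  ... | no _     | no _     = ⊤-large l

  probe-at-i : ∀ A {i j x} → i ≢ j → x ∈ probe A i j i → x ∈ A i
  probe-at-i A {i} {j} i≢j with i ≟ j | i ≟ i
  ... | yes i≡j | _        = ⊥-elim (i≢j i≡j)
  ... | no _    | yes _    = id
  ... | no _    | no i≢i   = ⊥-elim (i≢i refl)

  probe-at-j : ∀ A {i j x} → x ∈ probe A i j j → x ∈ ∁ (A j)
  probe-at-j A {i} {j} with j ≟ j
  ... | yes _   = id
  ... | no j≢j  = ⊥-elim (j≢j refl)

  module _ (dense : Dense) where

    closed-large⇒¬co-large : ∀ {A i j} → Closed A → i ≢ j → LargeIn i (A i) → ¬ LargeIn j (∁ (A j))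
    closed-large⇒¬co-large {A} {i} {j} closed i≢j Ai-large ∁Aj-large
      with dense (probe A i j) (probe-large A Ai-large ∁Aj-large)
    ... | e , e∈E , e∈U =
      x∈∁p⇒x∉p (probe-at-j A (e∈U j)) (closed e∈E (i , probe-at-i A i≢j (e∈U i)) j)

    closed-large⇒co-small : ∀ {A} → Closed A → Large A → Small (λ i → ∁ (A i))
    closed-large⇒co-small closed large i =
      ≰⇒> (closed-large⇒¬co-large closed (proj₂ (another i)) (large (proj₁ (another i))))

    closed⇒large⊎small : ∀ {C} → Closed C → Large C ⊎ Small C
    closed⇒large⊎small {C} closed = decide (all? (λ i → largeIn? i (C i)))
      where
      one-small⇒small : ∀ {i} → ¬ LargeIn i (C i) → Small C
      one-small⇒small {i} ¬Ci-large l with l ≟ i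
      ... | yes refl = ≰⇒> ¬Ci-large
      ... | no l≢i   = ≰⇒> (λ Cl-large →
        closed-large⇒¬co-large closed l≢i Cl-large (¬large⇒co-large {s = C i} ¬Ci-large))

      decide : Dec (Large C) → Large C ⊎ Small C
      decide (yes large) = inj₁ large
      decide (no ¬large) = inj₂ (one-small⇒small (proj₂ (¬∀⟶∃¬ _ _ (λ i → largeIn? i (C i)) ¬large)))

    large-─ᵛ-small : ∀ {A C} → Closed A → Large A → C ⊆ᵛ A → Small C → Large (A ─ᵛ C)
    large-─ᵛ-small {A} {C} closed large C⊆A small i =
      two-small⇒ε-large {∣ A i ─ C i ∣} {∣ C i ∣} {∣ ∁ (A i) ∣} partition
        (small i) (closed-large⇒co-small closed large i)
      where
      partition : ∣ A i ─ C i ∣ ℕ.+ ∣ C i ∣ ℕ.+ ∣ ∁ (A i) ∣ ≡ sizes i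
      partition = trans (cong (ℕ._+ ∣ ∁ (A i) ∣) (∣p─q∣+∣q∣≡∣p∣ (C⊆A i))) (∣p∣+∣∁p∣≡n (A i))

    Giant : Set
    Giant = ∃ λ (v : Vertex G) → (i : Fin (suc (suc k))) →
      ∃ λ (S : Subset (sizes i)) →
        ((x : Fin (sizes i)) → x ∈ S → Connected G v (i , x)) ×
        (((+ 1) / 1 - ε) * ⟦ sizes i ⟧ ≤ ⟦ ∣ S ∣ ⟧)

    large-component⇒giant : ∀ {C v} → Closed C → Large C → Reached v C → Giant
    large-component⇒giant {C} {v} C-closed C-large reached =
      v , λ i → C i , (λ _ → reached) ,
        co-small⇒[1-ε]-large ε {∣ C i ∣} {∣ ∁ (C i) ∣} (∣p∣+∣∁p∣≡n (C i))
          (closed-large⇒co-small C-closed C-large i)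

    giant⊎shrink : ∀ {A} → Closed A → Large A →
                   Giant ⊎ ∃ λ A′ → Closed A′ × Large A′ × ∣ A′ zero ∣ ℕ.< ∣ A zero ∣
    giant⊎shrink {A} closed large =
      let e , e∈E , e∈A = dense A large
          C , C-closed , e∈C , reached = edge-component e∈E zero
          C⊆A = reached⊆closed closed (e∈A zero) reached
      in Sum.map (λ C-large → large-component⇒giant C-closed C-large reached)
           (λ C-small → A ─ᵛ C , ─ᵛ-closed closed C-closed , large-─ᵛ-small closed large C⊆A C-small ,
                        p∩q≢∅⇒∣p─q∣<∣p∣ (A zero) (C zero) (e zero , x∈p∩q⁺ (e∈A zero , e∈C zero)))
           (closed⇒large⊎small C-closed)

    giant-within : ∀ A → Closed A → Large A → Acc ℕ._<_ ∣ A zero ∣ → Giant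
    giant-within A closed large (acc smaller) =
      [ id , (λ (A′ , closed′ , large′ , shrinks) → giant-within A′ closed′ large′ (smaller shrinks)) ]′
        (giant⊎shrink closed large)

    giant : Giant
    giant = giant-within (λ _ → ⊤) (λ _ _ j → ∈⊤) ⊤-large (<-wellFounded _)

lemma3p2 : (ε : ℚ) → (+ 0) / 1 < ε → ε < (+ 1) / 3 →
    (k : ℕ) → k ≥ 2 → (G : KPartite k) →
    ((U : (i : Fin k) → Subset (KPartite.sizes G i)) →
      ((i : Fin k) → ε * ⟦ KPartite.sizes G i ⟧ ≤ ⟦ ∣ U i ∣ ⟧) →
      ∃ λ e → (e ∈ₗ KPartite.edges G) × ((i : Fin k) → e i ∈ U i)) →
    ∃ λ (v : Vertex G) → (i : Fin k) →
      ∃ λ (S : Subset (KPartite.sizes G i)) →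
        ((x : Fin (KPartite.sizes G i)) → x ∈ S → Connected G v (i , x)) ×
        (((+ 1) / 1 - ε) * ⟦ KPartite.sizes G i ⟧ ≤ ⟦ ∣ S ∣ ⟧)
lemma3p2 ε 0<ε ε<⅓ (suc (suc k)) (s≤s (s≤s z≤n)) G dense =
  GiantComponent.giant ε (<⇒≤ 0<ε) (<⇒≤ ε<⅓) G dense
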